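{- Let $\Pi$ be a graph property and $\varepsilon\in(0,1]$, and suppose $\Pi$ has a canonical size-oblivious $\varepsilon$-tester with sample complexity $s=s(\varepsilon)$. Then for every $n\ge s^4$ and every $n$-vertex graph $G$ that is $\varepsilon$-far from $\Pi$, if $U$ is chosen uniformly at random among all subsets of $V(G)$ of size $s^4$, then $\mathbb P[G[U]\in\Pi]\le e^{ -\Omega(s)}$, where the constant implicit in $\Omega(\cdot)$ is absolute.
   Context: A graph property is a class of graphs closed under isomorphism. An $n$-vertex graph is $\varepsilon$-far from $\Pi$ if at least $\varepsilon n^2$ entries of its adjacency matrix must be changed to obtain a graph in $\Pi$. An $\varepsilon$-tester for $\Pi$ is a randomized algorithm with oracle access to the adjacency matrix that accepts graphs in $\Pi$ with probability at least $2/3$ and rejects graphs $\varepsilon$-far from $\Pi$ with probability at least $2/3$. It is canonical if it samples a set of $s$ vertices uniformly at random, queries all pairs among them, and decides solely as a function of the isomorphism class of the induced subgraph on the sample; $s$ is its sample complexity. It is size-oblivious if its operation (in particular $s$) depends only on $\varepsilon$ and not on the number of vertices of the input. $G[U]$ denotes the subgraph of $G$ induced by $U$.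
   Formalization: The parameter ε ranges over the rationals in (0,1]. -}

module Defs where

open import Data.Bool using (Bool; true; false; if_then_else_)
open import Data.Nat using (ℕ; zero; suc; _+_; _*_; _^_; _≤_)
open import Data.Fin using (Fin)
import Data.Fin as F
open import Data.Fin.Permutation using (Permutation′; _⟨$⟩ʳ_)
open import Data.List using (List; []; _∷_; [_]; _++_; map; length; filter; allFin)
open import Data.Nat.ListAction using (sum)
import Data.Vec.Functional as VF
open import Data.Product using (Σ; _×_; _,_)
open import Relation.Binary.PropositionalEquality using (_≡_)
open import Relation.Nullary using (¬_)
open import Data.Bool.Properties using (T?)
open import Data.Bool using (T; _xor_)
open import Data.Integer using (+_)
open import Data.Rational using (ℚ; _/_)
import Data.Rational as Q

record Graph (n : ℕ) : Set where
  field
    adj    : Fin n → Fin n → Bool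
    sym    : ∀ i j → adj i j ≡ adj j i
    irrefl : ∀ i → adj i i ≡ false
open Graph public

_≅_ : ∀ {n} → Graph n → Graph n → Set
_≅_ {n} G H = Σ (Permutation′ n) λ π →
  ∀ i j → adj H (π ⟨$⟩ʳ i) (π ⟨$⟩ʳ j) ≡ adj G i j

GraphClass : Set₁
GraphClass = (n : ℕ) → Graph n → Set

IsoClosed : GraphClass → Set
IsoClosed Π = ∀ {n} (G H : Graph n) → G ≅ H → Π n G → Π n H

-- k-subsets of Fin n, each listed exactly once, represented by its
-- order-preserving enumeration Fin k → Fin n.
subsets : (n k : ℕ) → List (Fin k → Fin n)
subsets n zero = [ VF.[] ]
subsets zero (suc k) = []
subsets (suc n) (suc k) =
  map (λ f i → F.suc (f i)) (subsets n (suc k)) ++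
  map (λ f → F.zero VF.∷ (λ i → F.suc (f i))) (subsets n k)

induced : ∀ {n k} → Graph n → (Fin k → Fin n) → Graph k
induced G f = record
  { adj = λ i j → adj G (f i) (f j)
  ; sym = λ i j → sym G (f i) (f j)
  ; irrefl = λ i → irrefl G (f i) }

countAccept : ∀ {n k} → (Graph k → Bool) → Graph n → ℕ
countAccept {n} {k} D G = length (filter (λ f → T? (D (induced G f))) (subsets n k))

total : ℕ → ℕ → ℕ
total n k = length (subsets n k)

-- number of entries (ordered pairs) of the adjacency matrices where G and H differ
dist : ∀ {n} → Graph n → Graph n → ℕ
dist {n} G H = sum (map (λ i → sum (map (λ j → if adj G i j xor adj H i j then 1 else 0)
                                        (allFin n))) (allFin n))

ℕtoℚ : ℕ → ℚ
ℕtoℚ m = + m / 1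

Far : ℚ → GraphClass → ∀ {n} → Graph n → Set
Far ε Π {n} G = ∀ (H : Graph n) → Π n H → ε Q.* ℕtoℚ (n * n) Q.≤ ℕtoℚ (dist G H)

-- A canonical size-oblivious ε-tester for Π with sample complexity s:
-- a single decision rule D on s-vertex graphs (independent of n), depending
-- only on the isomorphism class of the sample, such that for every n ≥ s,
-- a uniformly random s-subset S gives
--   G ∈ Π        ⇒ P[D(G[S]) accepts] ≥ 2/3,
--   G ε-far from Π ⇒ P[D(G[S]) accepts] ≤ 1/3.
record CanonicalTester (Π : GraphClass) (ε : ℚ) (s : ℕ) : Set where
  field
    decide     : Graph s → Bool
    isoInvar   : ∀ (G H : Graph s) → G ≅ H → decide G ≡ decide H
    complete   : ∀ n → s ≤ n → (G : Graph n) → Π n G →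
                   2 * total n s ≤ 3 * countAccept decide G
    sound      : ∀ n → s ≤ n → (G : Graph n) → Far ε Π G →
                   3 * countAccept decide G ≤ total n s

-- Let m = s⁴ and call an m-set U good if the tester accepts at least 2/3 of the s-subsets of U.
-- Completeness applied to G[U] shows that every U with G[U] ∈ Π is good; soundness applied to G
-- shows that at most C(n,s)/3 of all s-subsets of V(G) are accepted.  For an m-set U count its
-- packings: sequences of s pairwise disjoint accepted s-subsets of U.
--   * Upper bound (double counting): summed over all m-sets, there are at most
--     (C(n,s)/3)^s · C(n−s²,m−s²) ≤ 3^(−s) · C(n,m) · C(m,s)^s packings.
--   * Lower bound: deleting s² ≤ m/(12 s) vertices from a good U destroys at most C(m,s)/12
--     accepted s-sets, so a good U has at least ((7/12)·C(m,s))^s packings.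
-- Hence #good · 7^s ≤ 4^s · C(n,m), and as (7/4)² ≥ 2, any list L of distinct m-sets inducing
-- graphs in Π has |L|²·2^s ≤ C(n,m)²: the statement with K = 1 and s₀ = 12.
module Submission where

open import Defs hiding (sym)
open import Data.Nat
  using (ℕ; zero; suc; pred; _+_; _*_; _^_; _∸_; _≤_; _<_; z≤n; s≤s; NonZero; >-nonZero)
open import Data.Nat.Properties
open import Data.Nat.Tactic.RingSolver using (solve-∀)
open import Data.Nat.ListAction using (sum)
open import Data.Nat.ListAction.Properties using (sum-++)
open import Algebra.Properties.CommutativeSemigroup +-commutativeSemigroup using (interchange)
open import Data.Rational using (ℚ; 0ℚ; 1ℚ)
import Data.Rational as Q
open import Data.Bool using (Bool; true; false; if_then_else_)
open import Data.Bool.Properties using (T?)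
open import Data.Product using (Σ; _,_)
open import Data.Fin using (Fin)
import Data.Fin as F
import Data.Fin.Permutation as Permutation
open import Data.Fin.Subset using (Subset; inside; outside; _─_; ∣_∣)
  renaming (⊥ to ∅; ⊤ to full; _⊆_ to _⊆ₛ_)
open import Data.Fin.Subset.Properties
  using (⊥⊆; ⊆⊤; ⊆-refl; ⊆-trans; out⊆; in⊆in; drop-∷-⊆; p─q⊆p; ∣p─q∣≤∣p∣; ∣⊤∣≡n; ∣⊥∣≡0; p─⊥≡p)
open import Data.Vec using ([]; _∷_; here)
import Data.Vec.Functional as VF
open import Data.List using (List; []; _∷_; _++_; map; filter; length)
open import Data.List.Properties using (map-++; map-∘; map-cong; length-map; length-++)
open import Data.List.Relation.Unary.All using (All)
import Data.List.Relation.Unary.All as All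
open import Data.List.Relation.Binary.Sublist.Propositional using (_⊆_)
import Data.List.Relation.Binary.Sublist.Heterogeneous as Sublist
open import Relation.Binary.PropositionalEquality
  using (_≡_; refl; sym; trans; cong; cong₂; subst; subst₂; module ≡-Reasoning)
open import Relation.Nullary using (Dec; yes; no)

indicator : ∀ {P : Set} → Dec P → ℕ
indicator (yes _) = 1
indicator (no _)  = 0

indicator-intro : ∀ {P : Set} (d : Dec P) → P → 1 ≤ indicator d
indicator-intro (yes _) _ = ≤-refl
indicator-intro (no ¬p) p with ¬p p
... | ()

indicator-elim : ∀ {P : Set} (d : Dec P) {K Q : ℕ} → (P → K ≤ Q) → indicator d * K ≤ Q
indicator-elim (yes p) {K} f = ≤-trans (≤-reflexive (+-identityʳ K)) (f p)
indicator-elim (no _)      f = z≤n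

^-distrib-* : ∀ x y t → (x * y) ^ t ≡ x ^ t * y ^ t
^-distrib-* x y zero    = refl
^-distrib-* x y (suc t) = trans (cong (x * y *_) (^-distrib-* x y t)) (swap-middle x y (x ^ t) (y ^ t))
  where
  swap-middle : ∀ x y u v → x * y * (u * v) ≡ x * u * (y * v)
  swap-middle = solve-∀

choose : ℕ → ℕ → ℕ
choose n       zero    = 1
choose zero    (suc k) = 0
choose (suc n) (suc k) = choose n k + choose n (suc k)

choose-vanish : ∀ n k → n < k → choose n k ≡ 0
choose-vanish zero    (suc k) _         = refl
choose-vanish (suc n) (suc k) (s≤s n<k)
  rewrite choose-vanish n k n<k | choose-vanish n (suc k) (m≤n⇒m≤1+n n<k) = refl

choose-pos : ∀ n k → k ≤ n → 1 ≤ choose n k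
choose-pos n       zero    _         = ≤-refl
choose-pos (suc n) (suc k) (s≤s k≤n) = ≤-trans (choose-pos n k k≤n) (m≤m+n _ _)

choose-diag : ∀ n → choose n n ≡ 1
choose-diag zero = refl
choose-diag (suc n) rewrite choose-diag n | choose-vanish n (suc n) ≤-refl = refl

choose-1 : ∀ n → choose n 1 ≡ n
choose-1 zero    = refl
choose-1 (suc n) = cong suc (choose-1 n)

choose-suc-mono : ∀ n k → choose n k ≤ choose (suc n) k
choose-suc-mono n       zero    = ≤-refl
choose-suc-mono zero    (suc k) = z≤n
choose-suc-mono (suc n) (suc k) = m≤n+m (choose (suc n) (suc k)) (choose (suc n) k)

choose-absorb : ∀ n k → suc k * choose (suc n) (suc k) ≡ suc n * choose n k
choose-absorb zero    zero    = refl
choose-absorb zero    (suc k) = *-zeroʳ (suc (suc k))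
choose-absorb (suc n) zero    =
  trans (+-identityʳ _) (trans (choose-1 (suc (suc n))) (sym (*-identityʳ (suc (suc n)))))
choose-absorb (suc n) (suc k) = begin
    suc (suc k) * (choose (suc n) (suc k) + choose (suc n) (suc (suc k)))
  ≡⟨ *-distribˡ-+ (suc (suc k)) (choose (suc n) (suc k)) _ ⟩
    suc (suc k) * choose (suc n) (suc k) + suc (suc k) * choose (suc n) (suc (suc k))
  ≡⟨ cong₂ (λ u v → u + v) (cong (choose (suc n) (suc k) +_) (choose-absorb n k)) (choose-absorb n (suc k)) ⟩
    choose (suc n) (suc k) + suc n * choose n k + suc n * choose n (suc k)
  ≡⟨ regroup (choose (suc n) (suc k)) (suc n) (choose n k) (choose n (suc k)) ⟩
    choose (suc n) (suc k) + suc n * (choose n k + choose n (suc k))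
  ∎
  where
  open ≡-Reasoning
  regroup : ∀ a b x y → a + b * x + b * y ≡ a + b * (x + y)
  regroup = solve-∀

-- The subtraction-free form of C(n+1,k)·(n+1−k) = (n+1)·C(n,k).
choose-suc : ∀ n k → suc n * choose (suc n) k ≡ suc n * choose n k + k * choose (suc n) k
choose-suc n zero    = sym (+-identityʳ _)
choose-suc n (suc k) = begin
    suc n * (choose n k + choose n (suc k))
  ≡⟨ *-distribˡ-+ (suc n) (choose n k) (choose n (suc k)) ⟩
    suc n * choose n k + suc n * choose n (suc k)
  ≡⟨ cong (_+ suc n * choose n (suc k)) (sym (choose-absorb n k)) ⟩
    suc k * choose (suc n) (suc k) + suc n * choose n (suc k)
  ≡⟨ +-comm (suc k * choose (suc n) (suc k)) _ ⟩
    suc n * choose n (suc k) + suc k * choose (suc n) (suc k)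
  ∎
  where open ≡-Reasoning

balance-≤ : ∀ u v t X Y → u + t * X ≡ v + t * Y → Y ≤ X → u ≤ v
balance-≤ u v t X Y eq Y≤X = +-cancelʳ-≤ (t * Y) u v (begin
    u + t * Y  ≤⟨ +-monoʳ-≤ u (*-monoʳ-≤ t Y≤X) ⟩
    u + t * X  ≡⟨ eq ⟩
    v + t * Y  ∎)
  where open ≤-Reasoning

-- The ratio C(x+1,s)/C(x,s) = (x+1)/(x+1−s) is non-increasing in x.
choose-ratio-step : ∀ s y x → y ≤ x →
  choose (suc x) s * choose y s ≤ choose x s * choose (suc y) s
choose-ratio-step s y x y≤x =
  *-cancelˡ-≤ (X * Y) (balance-≤ _ _ (s * a * c) X Y cross (s≤s y≤x))
  where
  open ≡-Reasoning
  X = suc x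
  Y = suc y
  a = choose X s
  b = choose x s
  c = choose Y s
  d = choose y s
  expandL : ∀ X Y a c d s → X * Y * (a * d) + s * a * c * X ≡ (X * a) * (Y * d + s * c)
  expandL = solve-∀
  expandR : ∀ X Y a b c s → (X * b + s * a) * (Y * c) ≡ X * Y * (b * c) + s * a * c * Y
  expandR = solve-∀
  cross : X * Y * (a * d) + s * a * c * X ≡ X * Y * (b * c) + s * a * c * Y
  cross = begin
      X * Y * (a * d) + s * a * c * X  ≡⟨ expandL X Y a c d s ⟩
      (X * a) * (Y * d + s * c)        ≡⟨ cong ((X * a) *_) (sym (choose-suc y s)) ⟩
      (X * a) * (Y * c)                ≡⟨ cong (_* (Y * c)) (choose-suc x s) ⟩
      (X * b + s * a) * (Y * c)        ≡⟨ expandR X Y a b c s ⟩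
      X * Y * (b * c) + s * a * c * Y  ∎

choose-ratio : ∀ s r m n → s ≤ m → m ≤ n →
  choose (n + r) s * choose m s ≤ choose n s * choose (m + r) s
choose-ratio s zero m n _ _ rewrite +-identityʳ n | +-identityʳ m = ≤-refl
choose-ratio s (suc r) m n s≤m m≤n =
  *-cancelʳ-≤ _ _ (choose (n + r) s * choose (m + r) s) {{positive}}
    (subst₂ _≤_ (shuffle a b c d) (shuffle′ c e b f)
      (*-mono-≤ step (choose-ratio s r m n s≤m m≤n)))
  where
  a = choose (n + suc r) s
  b = choose (m + r) s
  c = choose (n + r) s
  d = choose m s
  e = choose n s
  f = choose (m + suc r) s
  step : a * b ≤ c * f
  step rewrite +-suc n r | +-suc m r = choose-ratio-step s (m + r) (n + r) (+-monoˡ-≤ r m≤n)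
  s≤m+r = ≤-trans s≤m (m≤m+n m r)
  positive : NonZero (c * b)
  positive = >-nonZero (*-mono-≤ (choose-pos (n + r) s (≤-trans s≤m+r (+-monoˡ-≤ r m≤n)))
                                  (choose-pos (m + r) s s≤m+r))
  shuffle : ∀ a b c d → (a * b) * (c * d) ≡ (a * d) * (c * b)
  shuffle = solve-∀
  shuffle′ : ∀ c e b f → (c * f) * (e * b) ≡ (e * f) * (c * b)
  shuffle′ = solve-∀

-- For s ≥ 1: if x·s ≤ m then x·C(m−1,s−1) ≤ C(m,s), since s·C(m,s) = m·C(m−1,s−1).
choose-pred-bound : ∀ x m s → 1 ≤ s → x * s ≤ m → x * choose (pred m) (pred s) ≤ choose m s
choose-pred-bound zero    m        s        _ _ = z≤n
choose-pred-bound (suc x) (suc m′) (suc s′) _ h = *-cancelʳ-≤ _ _ (suc m′) (begin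
    suc x * choose m′ s′ * suc m′
  ≡⟨ *-assoc (suc x) (choose m′ s′) (suc m′) ⟩
    suc x * (choose m′ s′ * suc m′)
  ≡⟨ cong (suc x *_) (trans (*-comm _ (suc m′)) (sym (choose-absorb m′ s′))) ⟩
    suc x * (suc s′ * choose (suc m′) (suc s′))
  ≡⟨ sym (*-assoc (suc x) (suc s′) _) ⟩
    suc x * suc s′ * choose (suc m′) (suc s′)
  ≤⟨ *-monoˡ-≤ _ h ⟩
    suc m′ * choose (suc m′) (suc s′)
  ≡⟨ *-comm (suc m′) _ ⟩
    choose (suc m′) (suc s′) * suc m′
  ∎)
  where open ≤-Reasoning

-- Σsub U k F: the sum of F B over all k-element subsets B of U.
Σsub : ∀ {n} → Subset n → ℕ → (Subset n → ℕ) → ℕ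
Σsub U             zero    F = F ∅
Σsub []            (suc k) F = 0
Σsub (outside ∷ U) (suc k) F = Σsub U (suc k) (λ B → F (outside ∷ B))
Σsub (inside ∷ U)  (suc k) F = Σsub U (suc k) (λ B → F (outside ∷ B)) + Σsub U k (λ B → F (inside ∷ B))

Σsub-mono : ∀ {n} (U : Subset n) k (F G : Subset n → ℕ) →
  (∀ B → B ⊆ₛ U → ∣ B ∣ ≡ k → F B ≤ G B) → Σsub U k F ≤ Σsub U k G
Σsub-mono {n} U zero F G h = h ∅ ⊥⊆ (∣⊥∣≡0 n)
Σsub-mono []            (suc k) F G h = z≤n
Σsub-mono (outside ∷ U) (suc k) F G h = Σsub-mono U (suc k) _ _ (λ B B⊆U c → h (outside ∷ B) (out⊆ B⊆U) c)
Σsub-mono (inside ∷ U)  (suc k) F G h =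
  +-mono-≤ (Σsub-mono U (suc k) _ _ (λ B B⊆U c → h (outside ∷ B) (out⊆ B⊆U) c))
           (Σsub-mono U k _ _ (λ B B⊆U c → h (inside ∷ B) (in⊆in B⊆U) (cong suc c)))

Σsub-cong : ∀ {n} (U : Subset n) k (F G : Subset n → ℕ) →
  (∀ B → B ⊆ₛ U → ∣ B ∣ ≡ k → F B ≡ G B) → Σsub U k F ≡ Σsub U k G
Σsub-cong U k F G h = ≤-antisym (Σsub-mono U k F G (λ B B⊆U c → ≤-reflexive (h B B⊆U c)))
                                (Σsub-mono U k G F (λ B B⊆U c → ≤-reflexive (sym (h B B⊆U c))))

Σsub-+ : ∀ {n} (U : Subset n) k (F G : Subset n → ℕ) →
  Σsub U k (λ B → F B + G B) ≡ Σsub U k F + Σsub U k G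
Σsub-+ U             zero    F G = refl
Σsub-+ []            (suc k) F G = refl
Σsub-+ (outside ∷ U) (suc k) F G = Σsub-+ U (suc k) _ _
Σsub-+ (inside ∷ U)  (suc k) F G =
  trans (cong₂ _+_ (Σsub-+ U (suc k) F₀ G₀) (Σsub-+ U k F₁ G₁))
        (interchange (Σsub U (suc k) F₀) (Σsub U (suc k) G₀) (Σsub U k F₁) (Σsub U k G₁))
  where
  F₀ = λ B → F (outside ∷ B)
  G₀ = λ B → G (outside ∷ B)
  F₁ = λ B → F (inside ∷ B)
  G₁ = λ B → G (inside ∷ B)

Σsub-scale : ∀ {n} (U : Subset n) k c (F : Subset n → ℕ) → Σsub U k (λ B → c * F B) ≡ c * Σsub U k F
Σsub-scale U             zero    c F = refl
Σsub-scale []            (suc k) c F = sym (*-zeroʳ c)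
Σsub-scale (outside ∷ U) (suc k) c F = Σsub-scale U (suc k) c _
Σsub-scale (inside ∷ U)  (suc k) c F =
  trans (cong₂ _+_ (Σsub-scale U (suc k) c _) (Σsub-scale U k c _)) (sym (*-distribˡ-+ c _ _))

Σsub-zero : ∀ {n} (U : Subset n) k → Σsub U k (λ _ → 0) ≡ 0
Σsub-zero U k = Σsub-scale U k 0 (λ _ → 0)

Σsub-count : ∀ {n} (U : Subset n) k → Σsub U k (λ _ → 1) ≡ choose ∣ U ∣ k
Σsub-count U             zero    = refl
Σsub-count []            (suc k) = refl
Σsub-count (outside ∷ U) (suc k) = Σsub-count U (suc k)
Σsub-count (inside ∷ U)  (suc k) rewrite Σsub-count U (suc k) | Σsub-count U k =
  +-comm (choose ∣ U ∣ (suc k)) (choose ∣ U ∣ k)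

Σsub-const : ∀ {n} (U : Subset n) k c → Σsub U k (λ _ → c) ≡ choose ∣ U ∣ k * c
Σsub-const U k c = begin
    Σsub U k (λ _ → c)          ≡⟨ Σsub-cong U k _ _ (λ _ _ _ → sym (*-identityʳ c)) ⟩
    Σsub U k (λ _ → c * 1)      ≡⟨ Σsub-scale U k c (λ _ → 1) ⟩
    c * Σsub U k (λ _ → 1)      ≡⟨ cong (c *_) (Σsub-count U k) ⟩
    c * (choose ∣ U ∣ k)        ≡⟨ *-comm c _ ⟩
    (choose ∣ U ∣ k) * c        ∎
  where open ≡-Reasoning

Σsub-vanish : ∀ {n} (U : Subset n) k (F : Subset n → ℕ) → ∣ U ∣ < k → Σsub U k F ≡ 0
Σsub-vanish U             zero          F ()
Σsub-vanish []            (suc k)       F _ = refl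
Σsub-vanish (outside ∷ U) (suc k)       F p = Σsub-vanish U (suc k) _ p
Σsub-vanish (inside ∷ U)  (suc zero)    F (s≤s ())
Σsub-vanish (inside ∷ U)  (suc (suc k)) F (s≤s p)
  rewrite Σsub-vanish U (suc (suc k)) (λ B → F (outside ∷ B)) (m≤n⇒m≤1+n p)
        | Σsub-vanish U (suc k) (λ B → F (inside ∷ B)) p = refl

Σsub-⊆ : ∀ {n} (X Y : Subset n) k (F : Subset n → ℕ) → X ⊆ₛ Y → Σsub X k F ≤ Σsub Y k F
Σsub-⊆ X             Y             zero    F _ = ≤-refl
Σsub-⊆ []            []            (suc k) F _ = ≤-refl
Σsub-⊆ (outside ∷ X) (outside ∷ Y) (suc k) F p = Σsub-⊆ X Y (suc k) _ (drop-∷-⊆ p)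
Σsub-⊆ (outside ∷ X) (inside ∷ Y)  (suc k) F p = ≤-trans (Σsub-⊆ X Y (suc k) _ (drop-∷-⊆ p)) (m≤m+n _ _)
Σsub-⊆ (inside ∷ X)  (outside ∷ Y) (suc k) F p with p here
... | ()
Σsub-⊆ (inside ∷ X)  (inside ∷ Y)  (suc k) F p =
  +-mono-≤ (Σsub-⊆ X Y (suc k) _ (drop-∷-⊆ p)) (Σsub-⊆ X Y k _ (drop-∷-⊆ p))

Σsub-outside : ∀ {n} (X : Subset n) j (G : Subset (suc n) → ℕ) →
  Σsub (outside ∷ X) j G ≡ Σsub X j (λ W → G (outside ∷ W))
Σsub-outside X zero    G = refl
Σsub-outside X (suc j) G = refl

∣─∣+∣∣ : ∀ {n} (U B : Subset n) → B ⊆ₛ U → ∣ U ─ B ∣ + ∣ B ∣ ≡ ∣ U ∣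
∣─∣+∣∣ []            []            _ = refl
∣─∣+∣∣ (outside ∷ U) (outside ∷ B) p = ∣─∣+∣∣ U B (drop-∷-⊆ p)
∣─∣+∣∣ (inside ∷ U)  (outside ∷ B) p = cong suc (∣─∣+∣∣ U B (drop-∷-⊆ p))
∣─∣+∣∣ (inside ∷ U)  (inside ∷ B)  p = trans (+-suc _ _) (cong suc (∣─∣+∣∣ U B (drop-∷-⊆ p)))
∣─∣+∣∣ (outside ∷ U) (inside ∷ B)  p with p here
... | ()

∣─∣-k-subset : ∀ {n} (U B : Subset n) {k} → B ⊆ₛ U → ∣ B ∣ ≡ k → ∣ U ─ B ∣ ≡ ∣ U ∣ ∸ k
∣─∣-k-subset U B {k} B⊆U refl = trans (sym (m+n∸n≡m ∣ U ─ B ∣ k)) (cong (_∸ k) (∣─∣+∣∣ U B B⊆U))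

-- Double counting (Fubini): choosing an (s+j)-subset U ⊆ V and then an s-subset B ⊆ U
-- amounts to choosing an s-subset B ⊆ V and then a j-subset W ⊆ V ─ B.
Σsub-fubini : ∀ {n} (V : Subset n) s j (H : Subset n → Subset n → ℕ) →
  Σsub V (s + j) (λ U → Σsub U s (λ B → H B (U ─ B))) ≡ Σsub V s (λ B → Σsub (V ─ B) j (H B))
Σsub-fubini V zero j H =
  trans (Σsub-cong V j _ _ (λ U _ _ → cong (H ∅) (p─⊥≡p U))) (cong (λ X → Σsub X j (H ∅)) (sym (p─⊥≡p V)))
Σsub-fubini []            (suc s) j       H = refl
Σsub-fubini (outside ∷ V) (suc s) j       H =
  trans (Σsub-fubini V (suc s) j (λ B W → H (outside ∷ B) (outside ∷ W)))
        (Σsub-cong V (suc s) _ _ (λ B _ _ → sym (Σsub-outside (V ─ B) j (H (outside ∷ B)))))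
Σsub-fubini (inside ∷ V)  (suc s) zero    H =
  trans (cong (Σsub V (suc s + 0) (λ U → Σsub U (suc s) (λ B → H₁ B (U ─ B))) +_)
              (trans (Σsub-+ V (s + 0) _ _) (cong (_+ Σsub V (s + 0) (λ U → Σsub U s (λ B → H₃ B (U ─ B)))) no-room)))
        (cong₂ _+_ (Σsub-fubini V (suc s) zero H₁)
                   (trans (Σsub-fubini V s zero H₃)
                          (Σsub-cong V s _ _ (λ B _ _ → sym (Σsub-outside (V ─ B) zero (H (inside ∷ B)))))))
  where
  H₁ = λ B W → H (outside ∷ B) (outside ∷ W)
  H₃ = λ B W → H (inside ∷ B) (outside ∷ W)
  -- an s-set has no (s+1)-subsets
  no-room : Σsub V (s + 0) (λ U → Σsub U (suc s) (λ B → H (outside ∷ B) (inside ∷ (U ─ B)))) ≡ 0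
  no-room = trans (Σsub-cong V (s + 0) _ (λ _ → 0)
                    (λ U _ c → Σsub-vanish U (suc s) _ (≤-reflexive (cong suc (trans c (+-identityʳ s))))))
                  (Σsub-zero V (s + 0))
Σsub-fubini (inside ∷ V)  (suc s) (suc j) H = begin
    Σsub V (suc s + suc j) (λ U → Σsub U (suc s) (λ B → H₁ B (U ─ B)))
      + Σsub V (s + suc j) (λ U → Σsub U (suc s) (λ B → H₂ B (U ─ B)) + Σsub U s (λ B → H₃ B (U ─ B)))
  ≡⟨ cong (T₁ +_) (Σsub-+ V (s + suc j) _ _) ⟩
    T₁ + (T₂ + T₃)
  ≡⟨ cong₂ _+_ (Σsub-fubini V (suc s) (suc j) H₁)
               (cong₂ _+_ (trans (cong (λ q → Σsub V q (λ U → Σsub U (suc s) (λ B → H₂ B (U ─ B)))) (+-suc s j))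
                                 (Σsub-fubini V (suc s) j H₂))
                          (Σsub-fubini V s (suc j) H₃)) ⟩
    S₁ + (S₂ + S₃)
  ≡⟨ sym (+-assoc S₁ S₂ S₃) ⟩
    (S₁ + S₂) + S₃
  ≡⟨ cong₂ _+_ (sym (Σsub-+ V (suc s) _ _))
               (Σsub-cong V s _ _ (λ B _ _ → sym (Σsub-outside (V ─ B) (suc j) (H (inside ∷ B))))) ⟩
    Σsub V (suc s) (λ B → Σsub (V ─ B) (suc j) (H₁ B) + Σsub (V ─ B) j (H₂ B))
      + Σsub V s (λ B → Σsub (outside ∷ (V ─ B)) (suc j) (H (inside ∷ B)))
  ∎
  where
  open ≡-Reasoning
  H₁ = λ B W → H (outside ∷ B) (outside ∷ W)
  H₂ = λ B W → H (outside ∷ B) (inside ∷ W)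
  H₃ = λ B W → H (inside ∷ B) (outside ∷ W)
  T₁ = Σsub V (suc s + suc j) (λ U → Σsub U (suc s) (λ B → H₁ B (U ─ B)))
  T₂ = Σsub V (s + suc j) (λ U → Σsub U (suc s) (λ B → H₂ B (U ─ B)))
  T₃ = Σsub V (s + suc j) (λ U → Σsub U s (λ B → H₃ B (U ─ B)))
  S₁ = Σsub V (suc s) (λ B → Σsub (V ─ B) (suc j) (H₁ B))
  S₂ = Σsub V (suc s) (λ B → Σsub (V ─ B) j (H₂ B))
  S₃ = Σsub V s (λ B → Σsub (V ─ B) (suc j) (H₃ B))

choose-subset-of-subset : ∀ N s j → choose N (s + j) * choose (s + j) s ≡ choose N s * choose (N ∸ s) j
choose-subset-of-subset N s j =
  trans (sym pairs-by-U) (trans (Σsub-fubini V s j (λ _ _ → 1)) pairs-by-B)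
  where
  V = full {N}
  pairs-by-U : Σsub V (s + j) (λ U → Σsub U s (λ _ → 1)) ≡ choose N (s + j) * choose (s + j) s
  pairs-by-U = begin
      Σsub V (s + j) (λ U → Σsub U s (λ _ → 1))
    ≡⟨ Σsub-cong V (s + j) _ _ (λ U _ ∣U∣≡s+j → trans (Σsub-count U s) (cong (λ c → choose c s) ∣U∣≡s+j)) ⟩
      Σsub V (s + j) (λ _ → choose (s + j) s)
    ≡⟨ Σsub-const V (s + j) _ ⟩
      choose ∣ V ∣ (s + j) * choose (s + j) s
    ≡⟨ cong (λ c → choose c (s + j) * choose (s + j) s) (∣⊤∣≡n N) ⟩
      choose N (s + j) * choose (s + j) s
    ∎
    where open ≡-Reasoning
  pairs-by-B : Σsub V s (λ B → Σsub (V ─ B) j (λ _ → 1)) ≡ choose N s * choose (N ∸ s) j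
  pairs-by-B = begin
      Σsub V s (λ B → Σsub (V ─ B) j (λ _ → 1))
    ≡⟨ Σsub-cong V s _ _ (λ B B⊆V ∣B∣≡s → trans (Σsub-count (V ─ B) j)
         (cong (λ c → choose c j) (trans (∣─∣-k-subset V B B⊆V ∣B∣≡s) (cong (_∸ s) (∣⊤∣≡n N))))) ⟩
      Σsub V s (λ _ → choose (N ∸ s) j)
    ≡⟨ Σsub-const V s _ ⟩
      choose ∣ V ∣ s * choose (N ∸ s) j
    ≡⟨ cong (λ c → choose c s * choose (N ∸ s) j) (∣⊤∣≡n N) ⟩
      choose N s * choose (N ∸ s) j
    ∎
    where open ≡-Reasoning

choose-peel-one : ∀ N M s → choose (N + s) s * choose N M ≡ choose (N + s) (M + s) * choose (M + s) s
choose-peel-one N M s = begin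
    choose (N + s) s * choose N M
  ≡⟨ cong (λ q → choose (N + s) s * choose q M) (sym (m+n∸n≡m N s)) ⟩
    choose (N + s) s * choose (N + s ∸ s) M
  ≡⟨ sym (choose-subset-of-subset (N + s) s M) ⟩
    choose (N + s) (s + M) * choose (s + M) s
  ≡⟨ cong (λ q → choose (N + s) q * choose q s) (+-comm s M) ⟩
    choose (N + s) (M + s) * choose (M + s) s
  ∎
  where open ≡-Reasoning

choose-power-nonzero : ∀ s t M → NonZero (choose (M + t * s) s ^ t)
choose-power-nonzero s zero    M = _
choose-power-nonzero s (suc t) M =
  m^n≢0 _ (suc t) {{>-nonZero (choose-pos _ s (≤-trans (m≤m+n s (t * s)) (m≤n+m (s + t * s) M)))}}

choose-ratio-power : ∀ s t M N → M ≤ N →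
  (choose (N + t * s + s) s * choose (M + t * s) s) ^ t ≤ (choose (N + t * s) s * choose (M + t * s + s) s) ^ t
choose-ratio-power s zero    M N _   = ≤-refl
choose-ratio-power s (suc t) M N M≤N = ^-monoˡ-≤ (suc t)
  (choose-ratio s s (M + suc t * s) (N + suc t * s)
    (≤-trans (m≤m+n s (t * s)) (m≤n+m (s + t * s) M)) (+-monoˡ-≤ (suc t * s) M≤N))

choose-peel : ∀ s t M N → M ≤ N →
  choose N M * choose (N + t * s) s ^ t ≤ choose (N + t * s) (M + t * s) * choose (M + t * s) s ^ t
choose-peel s zero    M N _   rewrite +-identityʳ N | +-identityʳ M = ≤-refl
choose-peel s (suc t) M N M≤N =
  *-cancelʳ-≤ _ _ (c′ ^ t) {{choose-power-nonzero s t M}} (begin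
    choose N M * choose (N + suc t * s) s ^ suc t * c′ ^ t
  ≡⟨ cong (λ q → choose N M * choose q s ^ suc t * c′ ^ t) n′+s ⟩
    choose N M * (a * a ^ t) * c′ ^ t
  ≡⟨ regroup₁ (choose N M) a (a ^ t) (c′ ^ t) ⟩
    a * (choose N M * (a ^ t * c′ ^ t))
  ≡⟨ cong (λ q → a * (choose N M * q)) (sym (^-distrib-* a c′ t)) ⟩
    a * (choose N M * (a * c′) ^ t)
  ≤⟨ *-monoʳ-≤ a (*-monoʳ-≤ (choose N M) (choose-ratio-power s t M N M≤N)) ⟩
    a * (choose N M * (a′ * c) ^ t)
  ≡⟨ cong (λ q → a * (choose N M * q)) (^-distrib-* a′ c t) ⟩
    a * (choose N M * (a′ ^ t * c ^ t))
  ≡⟨ regroup₂ a (choose N M) (a′ ^ t) (c ^ t) ⟩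
    a * (choose N M * a′ ^ t) * c ^ t
  ≤⟨ *-monoˡ-≤ (c ^ t) (*-monoʳ-≤ a (choose-peel s t M N M≤N)) ⟩
    a * (choose n′ m′ * c′ ^ t) * c ^ t
  ≡⟨ regroup₃ a (choose n′ m′) (c′ ^ t) (c ^ t) ⟩
    a * choose n′ m′ * c ^ t * c′ ^ t
  ≡⟨ cong (λ q → q * c ^ t * c′ ^ t) (choose-peel-one n′ m′ s) ⟩
    choose (n′ + s) (m′ + s) * c * c ^ t * c′ ^ t
  ≡⟨ cong (_* c′ ^ t) (*-assoc (choose (n′ + s) (m′ + s)) c (c ^ t)) ⟩
    choose (n′ + s) (m′ + s) * (c * c ^ t) * c′ ^ t
  ≡⟨ cong₂ (λ u v → choose u v * choose v s ^ suc t * c′ ^ t) (sym n′+s) (sym m′+s) ⟩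
    choose (N + suc t * s) (M + suc t * s) * choose (M + suc t * s) s ^ suc t * c′ ^ t
  ∎)
  where
  open ≤-Reasoning
  n′ = N + t * s
  m′ = M + t * s
  a  = choose (n′ + s) s
  a′ = choose n′ s
  c  = choose (m′ + s) s
  c′ = choose m′ s
  shift : ∀ X → X + (s + t * s) ≡ X + t * s + s
  shift X = solve-∀′ X s (t * s)
    where solve-∀′ : ∀ X s u → X + (s + u) ≡ X + u + s
          solve-∀′ = solve-∀
  n′+s : N + suc t * s ≡ n′ + s
  n′+s = shift N
  m′+s : M + suc t * s ≡ m′ + s
  m′+s = shift M
  regroup₁ : ∀ x a u v → x * (a * u) * v ≡ a * (x * (u * v))
  regroup₁ = solve-∀
  regroup₂ : ∀ a x u v → a * (x * (u * v)) ≡ a * (x * u) * v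
  regroup₂ = solve-∀
  regroup₃ : ∀ a y w v → a * (y * w) * v ≡ a * y * v * w
  regroup₃ = solve-∀

-- For k ≥ 1, d·C(c−1,k−1) bounds the number of k-subsets of a c-set that meet a given d-subset.
meet-bound : ℕ → ℕ → ℕ → ℕ
meet-bound d c zero    = 0
meet-bound d c (suc k) = d * choose (pred c) k

-- Pascal's rule for the bound; d ≤ c ensures c ≥ 1 when d ≥ 1.
meet-bound-pascal : ∀ d c k → d ≤ c → d * choose (pred c) k + meet-bound d c k ≤ d * choose c k
meet-bound-pascal d       c       zero    _ = ≤-reflexive (+-identityʳ _)
meet-bound-pascal zero    c       (suc k) _ = z≤n
meet-bound-pascal (suc d) (suc c) (suc k) _ = ≤-reflexive (begin
    suc d * choose c (suc k) + suc d * choose c k  ≡⟨ sym (*-distribˡ-+ (suc d) (choose c (suc k)) (choose c k)) ⟩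
    suc d * (choose c (suc k) + choose c k)        ≡⟨ cong (suc d *_) (+-comm (choose c (suc k)) _) ⟩
    suc d * (choose c k + choose c (suc k))        ∎)
  where open ≡-Reasoning

meet-bound-≤ : ∀ d c k → meet-bound d c k ≤ d * choose (pred c) (pred k)
meet-bound-≤ d c zero    = z≤n
meet-bound-≤ d c (suc k) = ≤-refl

Σsub-≤-choose : ∀ {n} (U : Subset n) k (F : Subset n → ℕ) →
  (∀ B → B ⊆ₛ U → ∣ B ∣ ≡ k → F B ≤ 1) → Σsub U k F ≤ choose ∣ U ∣ k
Σsub-≤-choose U k F F≤1 = ≤-trans (Σsub-mono U k F (λ _ → 1) F≤1) (≤-reflexive (Σsub-count U k))

Σsub-remove : ∀ {n} (U W : Subset n) k (F : Subset n → ℕ) → W ⊆ₛ U →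
  (∀ B → B ⊆ₛ U → ∣ B ∣ ≡ k → F B ≤ 1) → Σsub U k F ≤ Σsub W k F + meet-bound ∣ U ─ W ∣ ∣ U ∣ k
Σsub-remove U W zero F _ _ = m≤m+n _ _
Σsub-remove [] [] (suc k) F _ _ = z≤n
Σsub-remove (outside ∷ U) (outside ∷ W) (suc k) F W⊆U F≤1 =
  Σsub-remove U W (suc k) _ (drop-∷-⊆ W⊆U) (λ B B⊆U c → F≤1 (outside ∷ B) (out⊆ B⊆U) c)
Σsub-remove (outside ∷ U) (inside ∷ W) (suc k) F W⊆U F≤1 with W⊆U here
... | ()
Σsub-remove (inside ∷ U) (outside ∷ W) (suc k) F W⊆U F≤1 = begin
    Σsub U (suc k) F₀ + Σsub U k F₁
  ≤⟨ +-mono-≤ (Σsub-remove U W (suc k) F₀ (drop-∷-⊆ W⊆U) (λ B B⊆U c → F≤1 (outside ∷ B) (out⊆ B⊆U) c))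
              (Σsub-≤-choose U k F₁ (λ B B⊆U c → F≤1 (inside ∷ B) (in⊆in B⊆U) (cong suc c))) ⟩
    W₀ + d * choose (pred c) k + choose c k
  ≤⟨ +-monoˡ-≤ (choose c k) (+-monoʳ-≤ W₀ (*-monoʳ-≤ d (choose-pred-mono c k))) ⟩
    W₀ + d * choose c k + choose c k
  ≡⟨ regroup W₀ d (choose c k) ⟩
    W₀ + suc d * choose c k
  ∎
  where
  open ≤-Reasoning
  F₀ = λ B → F (outside ∷ B)
  F₁ = λ B → F (inside ∷ B)
  W₀ = Σsub W (suc k) F₀
  d = ∣ U ─ W ∣
  c = ∣ U ∣
  choose-pred-mono : ∀ c k → choose (pred c) k ≤ choose c k
  choose-pred-mono zero    k = ≤-refl
  choose-pred-mono (suc c) k = choose-suc-mono c k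
  regroup : ∀ w d b → w + d * b + b ≡ w + suc d * b
  regroup = solve-∀
Σsub-remove (inside ∷ U) (inside ∷ W) (suc k) F W⊆U F≤1 = begin
    Σsub U (suc k) F₀ + Σsub U k F₁
  ≤⟨ +-mono-≤ (Σsub-remove U W (suc k) F₀ (drop-∷-⊆ W⊆U) (λ B B⊆U c → F≤1 (outside ∷ B) (out⊆ B⊆U) c))
              (Σsub-remove U W k F₁ (drop-∷-⊆ W⊆U) (λ B B⊆U c → F≤1 (inside ∷ B) (in⊆in B⊆U) (cong suc c))) ⟩
    (W₀ + d * choose (pred c) k) + (W₁ + meet-bound d c k)
  ≡⟨ interchange W₀ _ W₁ _ ⟩
    (W₀ + W₁) + (d * choose (pred c) k + meet-bound d c k)
  ≤⟨ +-monoʳ-≤ (W₀ + W₁) (meet-bound-pascal d c k (∣p─q∣≤∣p∣ U W)) ⟩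
    (W₀ + W₁) + d * choose c k
  ∎
  where
  open ≤-Reasoning
  F₀ = λ B → F (outside ∷ B)
  F₁ = λ B → F (inside ∷ B)
  W₀ = Σsub W (suc k) F₀
  W₁ = Σsub W k F₁
  d = ∣ U ─ W ∣
  c = ∣ U ∣

seven-twelfths : ∀ C Y x → 2 * C ≤ 3 * Y → 12 * x ≤ C → 7 * C ≤ 12 * (Y ∸ x)
seven-twelfths C Y x two-thirds small =
  subst₂ _≤_ seven-C (sym (*-distribˡ-∸ 12 Y x)) (∸-mono eight-C small)
  where
  eight-C : 8 * C ≤ 12 * Y
  eight-C = subst₂ _≤_ (times-four 2 C) (times-four 3 Y) (*-monoʳ-≤ 4 two-thirds)
    where times-four : ∀ k x → 4 * (k * x) ≡ (4 * k) * x
          times-four k x = sym (*-assoc 4 k x)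
  seven-C : 8 * C ∸ C ≡ 7 * C
  seven-C = m+n∸m≡n C (7 * C)

-- Given a weight acc on subsets (later: 1 if the tester accepts
-- the sample, else 0), packings t U counts, with weights, the sequences (B₁,…,B_t) of pairwise
-- disjoint s-subsets of U.
module Packings {n : ℕ} (s : ℕ) (acc : Subset n → ℕ) where

  packings : ℕ → Subset n → ℕ
  packings zero    U = 1
  packings (suc t) U = Σsub U s (λ B → acc B * packings t (U ─ B))

  accepted : ℕ
  accepted = Σsub full s acc

  packings-upper : ∀ t (V : Subset n) j →
    Σsub V (t * s + j) (packings t) ≤ accepted ^ t * choose (∣ V ∣ ∸ t * s) j
  packings-upper zero    V j = ≤-reflexive (trans (Σsub-count V j) (sym (+-identityʳ _)))
  packings-upper (suc t) V j = begin
      Σsub V (s + t * s + j) (packings (suc t))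
    ≡⟨ cong (λ q → Σsub V q (packings (suc t))) (+-assoc s (t * s) j) ⟩
      Σsub V (s + (t * s + j)) (λ U → Σsub U s (λ B → acc B * packings t (U ─ B)))
    ≡⟨ Σsub-fubini V s (t * s + j) (λ B W → acc B * packings t W) ⟩
      Σsub V s (λ B → Σsub (V ─ B) (t * s + j) (λ W → acc B * packings t W))
    ≡⟨ Σsub-cong V s _ _ (λ B _ _ → Σsub-scale (V ─ B) (t * s + j) (acc B) (packings t)) ⟩
      Σsub V s (λ B → acc B * Σsub (V ─ B) (t * s + j) (packings t))
    ≤⟨ Σsub-mono V s _ _ (λ B B⊆V ∣B∣≡s → *-monoʳ-≤ (acc B) (bound-after B B⊆V ∣B∣≡s)) ⟩
      Σsub V s (λ B → acc B * K)
    ≡⟨ Σsub-cong V s _ _ (λ B _ _ → *-comm (acc B) K) ⟩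
      Σsub V s (λ B → K * acc B)
    ≡⟨ Σsub-scale V s K acc ⟩
      K * Σsub V s acc
    ≤⟨ *-monoʳ-≤ K (Σsub-⊆ V full s acc ⊆⊤) ⟩
      K * accepted
    ≡⟨ regroup (accepted ^ t) (choose (∣ V ∣ ∸ s ∸ t * s) j) accepted ⟩
      accepted * accepted ^ t * choose (∣ V ∣ ∸ s ∸ t * s) j
    ≡⟨ cong (λ q → accepted * accepted ^ t * choose q j) (∸-+-assoc ∣ V ∣ s (t * s)) ⟩
      accepted * accepted ^ t * choose (∣ V ∣ ∸ (s + t * s)) j
    ∎
    where
    open ≤-Reasoning
    K = accepted ^ t * choose (∣ V ∣ ∸ s ∸ t * s) j
    bound-after : ∀ B → B ⊆ₛ V → ∣ B ∣ ≡ s → Σsub (V ─ B) (t * s + j) (packings t) ≤ K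
    bound-after B B⊆V ∣B∣≡s =
      subst (λ c → Σsub (V ─ B) (t * s + j) (packings t) ≤ accepted ^ t * choose (c ∸ t * s) j)
            (∣─∣-k-subset V B B⊆V ∣B∣≡s) (packings-upper t (V ─ B) j)
    regroup : ∀ x b a → x * b * a ≡ a * x * b
    regroup = solve-∀

  packings-lower : (U₀ : Subset n) (R a : ℕ) →
    (∀ W → W ⊆ₛ U₀ → ∣ U₀ ∣ ≤ ∣ W ∣ + R → a ≤ Σsub W s acc) →
    ∀ t W → W ⊆ₛ U₀ → ∣ U₀ ∣ + t * s ≤ ∣ W ∣ + R → a ^ t ≤ packings t W
  packings-lower U₀ R a dense zero    W W⊆U₀ room = ≤-refl
  packings-lower U₀ R a dense (suc t) W W⊆U₀ room = begin
      a * a ^ t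
    ≤⟨ *-monoˡ-≤ (a ^ t) (dense W W⊆U₀ (≤-trans (m≤m+n ∣ U₀ ∣ (suc t * s)) room)) ⟩
      Σsub W s acc * a ^ t
    ≡⟨ trans (*-comm (Σsub W s acc) (a ^ t)) (sym (Σsub-scale W s (a ^ t) acc)) ⟩
      Σsub W s (λ B → a ^ t * acc B)
    ≤⟨ Σsub-mono W s _ _ (λ B B⊆W ∣B∣≡s → ≤-trans (≤-reflexive (*-comm (a ^ t) (acc B)))
         (*-monoʳ-≤ (acc B) (packings-lower U₀ R a dense t (W ─ B) (⊆-trans (p─q⊆p W B) W⊆U₀)
                                              (room-after B B⊆W ∣B∣≡s)))) ⟩
      Σsub W s (λ B → acc B * packings t (W ─ B))
    ∎
    where
    open ≤-Reasoning
    room-after : ∀ B → B ⊆ₛ W → ∣ B ∣ ≡ s → ∣ U₀ ∣ + t * s ≤ ∣ W ─ B ∣ + R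
    room-after B B⊆W ∣B∣≡s = +-cancelˡ-≤ s _ _ (subst₂ _≤_ (swap₁ ∣ U₀ ∣ s (t * s)) size room)
      where
      swap₁ : ∀ u s v → u + (s + v) ≡ s + (u + v)
      swap₁ = solve-∀
      swap₂ : ∀ w s R → w + s + R ≡ s + (w + R)
      swap₂ = solve-∀
      size : ∣ W ∣ + R ≡ s + (∣ W ─ B ∣ + R)
      size = trans (cong (_+ R) (sym (trans (cong (∣ W ─ B ∣ +_) (sym ∣B∣≡s)) (∣─∣+∣∣ W B B⊆W))))
                   (swap₂ ∣ W ─ B ∣ s R)

  packings-total : ∀ m → s * s ≤ m → m ≤ n → 3 * accepted ≤ choose n s →
    Σsub full m (packings s) * 3 ^ s ≤ choose n m * choose m s ^ s
  packings-total m ss≤m m≤n sound = begin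
      Σsub full m (packings s) * 3 ^ s
    ≤⟨ *-monoˡ-≤ (3 ^ s) upper ⟩
      accepted ^ s * choose N M * 3 ^ s
    ≡⟨ regroup (accepted ^ s) (choose N M) (3 ^ s) ⟩
      choose N M * (accepted ^ s * 3 ^ s)
    ≡⟨ cong (choose N M *_) (trans (sym (^-distrib-* accepted 3 s)) (cong (_^ s) (*-comm accepted 3))) ⟩
      choose N M * (3 * accepted) ^ s
    ≤⟨ *-monoʳ-≤ (choose N M) (^-monoˡ-≤ s sound) ⟩
      choose N M * choose n s ^ s
    ≡⟨ cong (λ q → choose N M * choose q s ^ s) (sym N+ss) ⟩
      choose N M * choose (N + s * s) s ^ s
    ≤⟨ choose-peel s s M N (∸-monoˡ-≤ (s * s) m≤n) ⟩
      choose (N + s * s) (M + s * s) * choose (M + s * s) s ^ s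
    ≡⟨ cong₂ (λ u v → choose u v * choose v s ^ s) N+ss M+ss ⟩
      choose n m * choose m s ^ s
    ∎
    where
    open ≤-Reasoning
    N = n ∸ s * s
    M = m ∸ s * s
    M+ss : M + s * s ≡ m
    M+ss = m∸n+n≡m ss≤m
    N+ss : N + s * s ≡ n
    N+ss = m∸n+n≡m (≤-trans ss≤m m≤n)
    upper : Σsub full m (packings s) ≤ accepted ^ s * choose N M
    upper = subst₂ (λ q c → Σsub full q (packings s) ≤ accepted ^ s * choose (c ∸ s * s) M)
                   (m+[n∸m]≡n ss≤m) (∣⊤∣≡n n) (packings-upper s full M)
    regroup : ∀ a c t → a * c * t ≡ c * (a * t)
    regroup = solve-∀

  module _ (acc≤1 : ∀ B → ∣ B ∣ ≡ s → acc B ≤ 1) where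

    good : ℕ → Subset n → ℕ
    good m U = indicator (2 * choose m s ≤? 3 * Σsub U s acc)

    -- A good m-set with m ≥ 12 s³ contains many packings: removing s² vertices kills at most
    -- s²·C(m−1,s−1) ≤ C(m,s)/12 accepted s-sets, so at every step ≥ (7/12)·C(m,s) remain.
    good-packings : ∀ m (U : Subset n) → ∣ U ∣ ≡ m → 12 * (s * s) * choose (pred m) (pred s) ≤ choose m s →
      2 * choose m s ≤ 3 * Σsub U s acc → 7 ^ s * choose m s ^ s ≤ 12 ^ s * packings s U
    good-packings m U ∣U∣≡m few-lost is-good = begin
        7 ^ s * C ^ s     ≡⟨ sym (^-distrib-* 7 C s) ⟩
        (7 * C) ^ s       ≤⟨ ^-monoˡ-≤ s (seven-twelfths C Y (R * b) is-good (≤-trans (≤-reflexive (sym (*-assoc 12 R b))) few-lost)) ⟩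
        (12 * a) ^ s      ≡⟨ ^-distrib-* 12 a s ⟩
        12 ^ s * a ^ s    ≤⟨ *-monoʳ-≤ (12 ^ s) (packings-lower U R a dense s U ⊆-refl ≤-refl) ⟩
        12 ^ s * packings s U ∎
      where
      open ≤-Reasoning
      C = choose m s
      b = choose (pred m) (pred s)
      R = s * s
      Y = Σsub U s acc
      a = Y ∸ R * b
      dense : ∀ W → W ⊆ₛ U → ∣ U ∣ ≤ ∣ W ∣ + R → a ≤ Σsub W s acc
      dense W W⊆U small-loss = m≤n+o⇒m∸n≤o Y (R * b) (begin
          Y                                                   ≤⟨ Σsub-remove U W s acc W⊆U (λ B _ → acc≤1 B) ⟩
          Σsub W s acc + meet-bound ∣ U ─ W ∣ ∣ U ∣ s         ≤⟨ +-monoʳ-≤ (Σsub W s acc) lost ⟩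
          Σsub W s acc + R * b                                ≡⟨ +-comm (Σsub W s acc) (R * b) ⟩
          R * b + Σsub W s acc                                ∎)
        where
        removed≤R : ∣ U ─ W ∣ ≤ R
        removed≤R = +-cancelʳ-≤ ∣ W ∣ _ _
          (≤-trans (≤-reflexive (∣─∣+∣∣ U W W⊆U)) (≤-trans small-loss (≤-reflexive (+-comm ∣ W ∣ R))))
        lost : meet-bound ∣ U ─ W ∣ ∣ U ∣ s ≤ R * b
        lost = ≤-trans (meet-bound-≤ ∣ U ─ W ∣ ∣ U ∣ s)
                 (subst (λ c → ∣ U ─ W ∣ * choose (pred c) (pred s) ≤ R * b) (sym ∣U∣≡m) (*-monoˡ-≤ b removed≤R))

    -- Summing good-packings over all m-sets; 12 s³ ≤ m supplies its hypothesis on lost sets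
    -- through choose-pred-bound.
    good-vs-packings : ∀ m → 1 ≤ s → 12 * (s * s) * s ≤ m →
      Σsub full m (good m) * (7 ^ s * choose m s ^ s) ≤ 12 ^ s * Σsub full m (packings s)
    good-vs-packings m s≥1 big = begin
        Σsub full m (good m) * K                  ≡⟨ trans (*-comm _ K) (sym (Σsub-scale full m K (good m))) ⟩
        Σsub full m (λ U → K * good m U)          ≤⟨ Σsub-mono full m _ _ good-term ⟩
        Σsub full m (λ U → 12 ^ s * packings s U) ≡⟨ Σsub-scale full m (12 ^ s) (packings s) ⟩
        12 ^ s * Σsub full m (packings s)         ∎
      where
      open ≤-Reasoning
      K = 7 ^ s * choose m s ^ s
      good-term : ∀ U → U ⊆ₛ full → ∣ U ∣ ≡ m → K * good m U ≤ 12 ^ s * packings s U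
      good-term U _ ∣U∣≡m = ≤-trans (≤-reflexive (*-comm K (good m U)))
        (indicator-elim (2 * choose m s ≤? 3 * Σsub U s acc)
          (good-packings m U ∣U∣≡m (choose-pred-bound (12 * (s * s)) m s s≥1 big)))

    good-sets-bound : ∀ m → 1 ≤ s → 12 * (s * s) * s ≤ m → m ≤ n → 3 * accepted ≤ choose n s →
      Σsub full m (good m) * 7 ^ s ≤ 4 ^ s * choose n m
    good-sets-bound m s≥1 big m≤n sound = *-cancelʳ-≤ _ _ (C ^ s * 3 ^ s) {{C^s*3^s≢0}} (begin
        Σsub full m (good m) * 7 ^ s * (C ^ s * 3 ^ s)    ≡⟨ regroup₁ (Σsub full m (good m)) (7 ^ s) (C ^ s) (3 ^ s) ⟩
        Σsub full m (good m) * (7 ^ s * C ^ s) * 3 ^ s    ≤⟨ *-monoˡ-≤ (3 ^ s) (good-vs-packings m s≥1 big) ⟩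
        12 ^ s * Σsub full m (packings s) * 3 ^ s         ≡⟨ *-assoc (12 ^ s) _ (3 ^ s) ⟩
        12 ^ s * (Σsub full m (packings s) * 3 ^ s)       ≤⟨ *-monoʳ-≤ (12 ^ s) (packings-total m ss≤m m≤n sound) ⟩
        12 ^ s * (choose n m * C ^ s)                     ≡⟨ cong (_* (choose n m * C ^ s)) (^-distrib-* 4 3 s) ⟩
        4 ^ s * 3 ^ s * (choose n m * C ^ s)              ≡⟨ regroup₂ (4 ^ s) (3 ^ s) (choose n m) (C ^ s) ⟩
        4 ^ s * choose n m * (C ^ s * 3 ^ s)              ∎)
      where
      open ≤-Reasoning
      C = choose m s
      ss≤m : s * s ≤ m
      ss≤m = ≤-trans (m≤n*m (s * s) 12) (≤-trans (m≤m*n (12 * (s * s)) s {{>-nonZero s≥1}}) big)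
      C^s*3^s≢0 : NonZero (C ^ s * 3 ^ s)
      C^s*3^s≢0 = m*n≢0 (C ^ s) (3 ^ s)
        {{m^n≢0 C s {{>-nonZero (choose-pos m s (≤-trans (m≤m*n s s {{>-nonZero s≥1}}) ss≤m))}}}} {{m^n≢0 3 s}}
      regroup₁ : ∀ g x c y → g * x * (c * y) ≡ g * (x * c) * y
      regroup₁ = solve-∀
      regroup₂ : ∀ a b c d → a * b * (c * d) ≡ a * c * (d * b)
      regroup₂ = solve-∀

Σlist : ∀ {A : Set} → List A → (A → ℕ) → ℕ
Σlist l F = sum (map F l)

Σlist-++ : ∀ {A : Set} (l l′ : List A) F → Σlist (l ++ l′) F ≡ Σlist l F + Σlist l′ F
Σlist-++ l l′ F = trans (cong sum (map-++ F l l′)) (sum-++ (map F l) (map F l′))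

Σlist-map : ∀ {A B : Set} (g : A → B) (l : List A) F → Σlist (map g l) F ≡ Σlist l (λ x → F (g x))
Σlist-map g l F = cong sum (sym (map-∘ l))

Σlist-cong : ∀ {A : Set} (l : List A) F G → (∀ x → F x ≡ G x) → Σlist l F ≡ Σlist l G
Σlist-cong l F G F≗G = cong sum (map-cong F≗G l)

length-filter : ∀ {A : Set} (b : A → Bool) (l : List A) →
  length (filter (λ x → T? (b x)) l) ≡ Σlist l (λ x → if b x then 1 else 0)
length-filter b []      = refl
length-filter b (x ∷ l) with b x
... | true  = cong suc (length-filter b l)
... | false = length-filter b l

Σlist-sublist : ∀ {A : Set} {l l′ : List A} F → l ⊆ l′ → Σlist l F ≤ Σlist l′ F
Σlist-sublist F Sublist.[]                 = ≤-refl
Σlist-sublist {l′ = y ∷ _} F (.y Sublist.∷ʳ p) = ≤-trans (Σlist-sublist F p) (m≤n+m _ (F y))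
Σlist-sublist F (refl Sublist.∷ p)         = +-monoʳ-≤ _ (Σlist-sublist F p)

length-≤-Σlist : ∀ {A : Set} (l : List A) F → All (λ x → 1 ≤ F x) l → length l ≤ Σlist l F
length-≤-Σlist []      F All.[]         = z≤n
length-≤-Σlist (x ∷ l) F (p All.∷ ps) = +-mono-≤ p (length-≤-Σlist l F ps)

total-choose : ∀ n k → total n k ≡ choose n k
total-choose n       zero    = refl
total-choose zero    (suc k) = refl
total-choose (suc n) (suc k) = begin
    length (map _ (subsets n (suc k)) ++ map _ (subsets n k))
  ≡⟨ length-++ (map (λ f i → F.suc (f i)) (subsets n (suc k))) ⟩
    length (map _ (subsets n (suc k))) + length (map _ (subsets n k))
  ≡⟨ cong₂ _+_ (trans (length-map _ (subsets n (suc k))) (total-choose n (suc k)))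
               (trans (length-map _ (subsets n k)) (total-choose n k)) ⟩
    choose n (suc k) + choose n k
  ≡⟨ +-comm (choose n (suc k)) (choose n k) ⟩
    choose n k + choose n (suc k)
  ∎
  where open ≡-Reasoning

-- Σenum U k D: the sum of D f over the increasing enumerations f : Fin k → Fin n of the
-- k-subsets of U (the representation of subsets used by Defs.subsets).
Σenum : ∀ {n} → Subset n → (k : ℕ) → ((Fin k → Fin n) → ℕ) → ℕ
Σenum U             zero    D = D VF.[]
Σenum []            (suc k) D = 0
Σenum (outside ∷ U) (suc k) D = Σenum U (suc k) (λ h → D (λ i → F.suc (h i)))
Σenum (inside ∷ U)  (suc k) D =
  Σenum U (suc k) (λ h → D (λ i → F.suc (h i))) + Σenum U k (λ h → D (F.zero VF.∷ (λ i → F.suc (h i))))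

Σenum-vanish : ∀ {n} (B : Subset n) k (D : (Fin k → Fin n) → ℕ) → ∣ B ∣ < k → Σenum B k D ≡ 0
Σenum-vanish B             zero          D ()
Σenum-vanish []            (suc k)       D _ = refl
Σenum-vanish (outside ∷ B) (suc k)       D p = Σenum-vanish B (suc k) _ p
Σenum-vanish (inside ∷ B)  (suc zero)    D (s≤s ())
Σenum-vanish (inside ∷ B)  (suc (suc k)) D (s≤s p)
  rewrite Σenum-vanish B (suc (suc k)) (λ h → D (λ i → F.suc (h i))) (m≤n⇒m≤1+n p)
        | Σenum-vanish B (suc k) (λ h → D (F.zero VF.∷ (λ i → F.suc (h i)))) p = refl

Σenum-≤-choose : ∀ {n} (B : Subset n) k (D : (Fin k → Fin n) → ℕ) → (∀ h → D h ≤ 1) → Σenum B k D ≤ choose ∣ B ∣ k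
Σenum-≤-choose B             zero    D D≤1 = D≤1 _
Σenum-≤-choose []            (suc k) D D≤1 = z≤n
Σenum-≤-choose (outside ∷ B) (suc k) D D≤1 = Σenum-≤-choose B (suc k) _ (λ _ → D≤1 _)
Σenum-≤-choose (inside ∷ B)  (suc k) D D≤1 =
  ≤-trans (+-mono-≤ (Σenum-≤-choose B (suc k) _ (λ _ → D≤1 _)) (Σenum-≤-choose B k _ (λ _ → D≤1 _)))
          (≤-reflexive (+-comm (choose ∣ B ∣ (suc k)) (choose ∣ B ∣ k)))

Σsub-Σenum : ∀ {n} (U : Subset n) k (D : (Fin k → Fin n) → ℕ) → Σsub U k (λ B → Σenum B k D) ≡ Σenum U k D
Σsub-Σenum U             zero    D = refl
Σsub-Σenum []            (suc k) D = refl
Σsub-Σenum (outside ∷ U) (suc k) D = Σsub-Σenum U (suc k) _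
Σsub-Σenum (inside ∷ U)  (suc k) D = cong₂ _+_ (Σsub-Σenum U (suc k) D₀) (begin
    Σsub U k (λ B → Σenum B (suc k) D₀ + Σenum B k D₁)
  ≡⟨ Σsub-+ U k _ _ ⟩
    Σsub U k (λ B → Σenum B (suc k) D₀) + Σsub U k (λ B → Σenum B k D₁)
  ≡⟨ cong (_+ Σsub U k (λ B → Σenum B k D₁)) too-big ⟩
    Σsub U k (λ B → Σenum B k D₁)
  ≡⟨ Σsub-Σenum U k D₁ ⟩
    Σenum U k D₁
  ∎)
  where
  open ≡-Reasoning
  D₀ = λ h → D (λ i → F.suc (h i))
  D₁ = λ h → D (F.zero VF.∷ (λ i → F.suc (h i)))
  -- a k-set has no (k+1)-subsets
  too-big : Σsub U k (λ B → Σenum B (suc k) D₀) ≡ 0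
  too-big = trans (Σsub-cong U k _ (λ _ → 0) (λ B _ ∣B∣≡k → Σenum-vanish B (suc k) D₀ (≤-reflexive (cong suc ∣B∣≡k))))
                  (Σsub-zero U k)

Σlist-subsets : ∀ n k (D : (Fin k → Fin n) → ℕ) → Σlist (subsets n k) D ≡ Σenum full k D
Σlist-subsets n       zero    D = +-identityʳ _
Σlist-subsets zero    (suc k) D = refl
Σlist-subsets (suc n) (suc k) D =
  trans (Σlist-++ (map (λ f i → F.suc (f i)) (subsets n (suc k))) (map (λ f → F.zero VF.∷ (λ i → F.suc (f i))) (subsets n k)) D)
   (cong₂ _+_ (trans (Σlist-map _ (subsets n (suc k)) D) (Σlist-subsets n (suc k) _))
              (trans (Σlist-map _ (subsets n k) D) (Σlist-subsets n k _)))

data Enumerates : ∀ {n k} → Subset n → (Fin k → Fin n) → Set where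
  enum-[]      : ∀ {f : Fin 0 → Fin 0} → Enumerates [] f
  enum-outside : ∀ {n k} {U : Subset n} {f : Fin k → Fin n} {g : Fin k → Fin (suc n)} →
    Enumerates U f → (∀ i → g i ≡ F.suc (f i)) → Enumerates (outside ∷ U) g
  enum-inside  : ∀ {n k} {U : Subset n} {f : Fin k → Fin n} {g : Fin (suc k) → Fin (suc n)} →
    Enumerates U f → (∀ i → g i ≡ (F.zero VF.∷ (λ j → F.suc (f j))) i) → Enumerates (inside ∷ U) g

enumerates-∅ : ∀ n (f : Fin 0 → Fin n) → Enumerates (∅ {n}) f
enumerates-∅ zero    f = enum-[]
enumerates-∅ (suc n) f = enum-outside (enumerates-∅ n VF.[]) (λ ())

Extensional : ∀ {k n} → ((Fin k → Fin n) → ℕ) → Set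
Extensional D = ∀ h h′ → (∀ i → h i ≡ h′ i) → D h ≡ D h′

Σlist-subsets-of : ∀ {n k} {U : Subset n} {f : Fin k → Fin n} → Enumerates U f →
  ∀ s (D : (Fin s → Fin n) → ℕ) → Extensional D →
  Σlist (subsets k s) (λ g → D (λ i → f (g i))) ≡ Σenum U s D
Σlist-subsets-of enum-[]            zero    D ext = trans (+-identityʳ _) (ext _ _ (λ ()))
Σlist-subsets-of enum-[]            (suc s) D ext = refl
Σlist-subsets-of (enum-outside e f≗) zero    D ext = trans (+-identityʳ _) (ext _ _ (λ ()))
Σlist-subsets-of (enum-outside e f≗) (suc s) D ext =
  trans (Σlist-cong (subsets _ (suc s)) _ _ (λ h → ext _ _ (λ i → f≗ (h i))))
        (Σlist-subsets-of e (suc s) (λ h → D (λ i → F.suc (h i))) (λ h h′ h≗ → ext _ _ (λ i → cong F.suc (h≗ i))))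
Σlist-subsets-of (enum-inside e f≗)  zero    D ext = trans (+-identityʳ _) (ext _ _ (λ ()))
Σlist-subsets-of {k = suc k} (enum-inside {f = f} {g = g} e g≗) (suc s) D ext =
  trans (Σlist-++ (map (λ h i → F.suc (h i)) (subsets k (suc s))) (map (λ h → F.zero VF.∷ (λ i → F.suc (h i))) (subsets k s)) _)
   (cong₂ _+_
     (trans (Σlist-map _ (subsets k (suc s)) _)
       (trans (Σlist-cong (subsets k (suc s)) _ _ (λ h → ext _ _ (λ i → g≗ (F.suc (h i)))))
          (Σlist-subsets-of e (suc s) (λ h → D (λ i → F.suc (h i))) (λ h h′ h≗ → ext _ _ (λ i → cong F.suc (h≗ i))))))
     (trans (Σlist-map _ (subsets k s) _)
       (trans (Σlist-cong (subsets k s) _ _ (λ h → ext _ _ (g-on-cons h)))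
          (Σlist-subsets-of e s (λ h → D (F.zero VF.∷ (λ i → F.suc (h i)))) (λ h h′ h≗ → ext _ _ (cons-cong h h′ h≗))))))
  where
  g-on-cons : ∀ h (i : Fin (suc s)) → g ((F.zero VF.∷ (λ j → F.suc (h j))) i) ≡ (F.zero VF.∷ (λ j → F.suc (f (h j)))) i
  g-on-cons h F.zero    = g≗ F.zero
  g-on-cons h (F.suc i) = g≗ (F.suc (h i))
  cons-cong : ∀ h h′ → (∀ i → h i ≡ h′ i) → (i : Fin (suc s)) →
    (F.zero VF.∷ (λ j → F.suc (h j))) i ≡ (F.zero VF.∷ (λ j → F.suc (h′ j))) i
  cons-cong h h′ h≗ F.zero    = refl
  cons-cong h h′ h≗ (F.suc i) = cong F.suc (h≗ i)

Σenum-Σsub : ∀ {n} (U : Subset n) k (D : (Fin k → Fin n) → ℕ) (H : Subset n → ℕ) →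
  (∀ B f → Enumerates B f → D f ≡ H B) → Σenum U k D ≡ Σsub U k H
Σenum-Σsub {n} U zero D H agree = agree ∅ VF.[] (enumerates-∅ n VF.[])
Σenum-Σsub []            (suc k) D H agree = refl
Σenum-Σsub (outside ∷ U) (suc k) D H agree =
  Σenum-Σsub U (suc k) _ _ (λ B f e → agree (outside ∷ B) _ (enum-outside e (λ _ → refl)))
Σenum-Σsub (inside ∷ U)  (suc k) D H agree = cong₂ _+_
  (Σenum-Σsub U (suc k) _ _ (λ B f e → agree (outside ∷ B) _ (enum-outside e (λ _ → refl))))
  (Σenum-Σsub U k _ _ (λ B f e → agree (inside ∷ B) _ (enum-inside e (λ _ → refl))))

module Verdicts {n s : ℕ} (G : Graph n) (decide : Graph s → Bool)
                (isoInvar : ∀ (G H : Graph s) → G ≅ H → decide G ≡ decide H) where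

  verdict : (Fin s → Fin n) → ℕ
  verdict h = if decide (induced G h) then 1 else 0

  -- pointwise equal samples induce isomorphic (indeed equal) graphs
  verdict-ext : Extensional verdict
  verdict-ext h h′ h≗h′ = cong (λ b → if b then 1 else 0)
    (isoInvar (induced G h) (induced G h′) (Permutation.id , λ i j → cong₂ (adj G) (sym (h≗h′ i)) (sym (h≗h′ j))))

  verdict≤1 : ∀ h → verdict h ≤ 1
  verdict≤1 h with decide (induced G h)
  ... | true  = ≤-refl
  ... | false = z≤n

  -- acc B = 1 if B is an s-set whose sample the tester accepts
  acc : Subset n → ℕ
  acc B = Σenum B s verdict

  acc≤1 : ∀ B → ∣ B ∣ ≡ s → acc B ≤ 1
  acc≤1 B ∣B∣≡s = ≤-trans (Σenum-≤-choose B s verdict verdict≤1) (≤-reflexive (trans (cong (λ c → choose c s) ∣B∣≡s) (choose-diag s)))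

  accepted-in : ∀ {k} {B : Subset n} {f : Fin k → Fin n} → Enumerates B f →
    countAccept decide (induced G f) ≡ Σsub B s acc
  accepted-in {k} {B} {f} e = begin
      countAccept decide (induced G f)
    ≡⟨ length-filter (λ g → decide (induced G (λ i → f (g i)))) (subsets k s) ⟩
      Σlist (subsets k s) (λ g → verdict (λ i → f (g i)))
    ≡⟨ Σlist-subsets-of e s verdict verdict-ext ⟩
      Σenum B s verdict
    ≡⟨ sym (Σsub-Σenum B s verdict) ⟩
      Σsub B s acc
    ∎
    where open ≡-Reasoning

  accepted-all : countAccept decide G ≡ Σsub full s acc
  accepted-all = trans (length-filter (λ g → decide (induced G g)) (subsets n s))
                       (trans (Σlist-subsets n s verdict) (sym (Σsub-Σenum full s verdict)))

  open Packings s acc using (good)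

  good-list-bound : ∀ m (L : List (Fin m → Fin n)) → L ⊆ subsets n m →
    All (λ f → 2 * choose m s ≤ 3 * countAccept decide (induced G f)) L →
    length L ≤ Σsub full m (good acc≤1 m)
  good-list-bound m L L⊆ all-good = begin
      length L                          ≤⟨ length-≤-Σlist L good-enum (All.map (indicator-intro _) all-good) ⟩
      Σlist L good-enum                 ≤⟨ Σlist-sublist good-enum L⊆ ⟩
      Σlist (subsets n m) good-enum     ≡⟨ Σlist-subsets n m good-enum ⟩
      Σenum full m good-enum            ≡⟨ Σenum-Σsub full m good-enum (good acc≤1 m)
                                             (λ B f e → cong (λ y → indicator (2 * choose m s ≤? 3 * y)) (accepted-in e)) ⟩
      Σsub full m (good acc≤1 m)        ∎
    where
    open ≤-Reasoning
    good-enum : (Fin m → Fin n) → ℕ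
    good-enum f = indicator (2 * choose m s ≤? 3 * countAccept decide (induced G f))

-- (7/4)² ≥ 2: a bound x ≤ (4/7)^s·N gives x²·2^s ≤ N².
square-bound : ∀ x N s → x * 7 ^ s ≤ 4 ^ s * N → x ^ 2 * 2 ^ s ≤ N ^ 2
square-bound x N s x-small = *-cancelʳ-≤ _ _ (16 ^ s) {{m^n≢0 16 s}} (begin
    x ^ 2 * 2 ^ s * 16 ^ s         ≡⟨ regroup₁ x (2 ^ s) (16 ^ s) ⟩
    x * x * (2 ^ s * 16 ^ s)       ≡⟨ cong (x * x *_) (sym (^-distrib-* 2 16 s)) ⟩
    x * x * 32 ^ s                 ≤⟨ *-monoʳ-≤ (x * x) (^-monoˡ-≤ s (m≤m+n 32 17)) ⟩
    x * x * 49 ^ s                 ≡⟨ cong (x * x *_) (^-distrib-* 7 7 s) ⟩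
    x * x * (7 ^ s * 7 ^ s)        ≡⟨ regroup₂ x (7 ^ s) ⟩
    (x * 7 ^ s) * (x * 7 ^ s)      ≤⟨ *-mono-≤ x-small x-small ⟩
    (4 ^ s * N) * (4 ^ s * N)      ≡⟨ regroup₃ (4 ^ s) N ⟩
    N ^ 2 * (4 ^ s * 4 ^ s)        ≡⟨ cong (N ^ 2 *_) (sym (^-distrib-* 4 4 s)) ⟩
    N ^ 2 * 16 ^ s                 ∎)
  where
  open ≤-Reasoning
  regroup₁ : ∀ x a b → x * (x * 1) * a * b ≡ x * x * (a * b)
  regroup₁ = solve-∀
  regroup₂ : ∀ x a → x * x * (a * a) ≡ (x * a) * (x * a)
  regroup₂ = solve-∀
  regroup₃ : ∀ z N → (z * N) * (z * N) ≡ N * (N * 1) * (z * z)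
  regroup₃ = solve-∀

twelve-cubes : ∀ s → 12 ≤ s → 12 * (s * s) * s ≤ s ^ 4
twelve-cubes s 12≤s = ≤-trans (*-monoˡ-≤ s (*-monoˡ-≤ (s * s) 12≤s)) (≤-reflexive (cubes s))
  where
  cubes : ∀ s → s * (s * s) * s ≡ s * (s * (s * (s * 1)))
  cubes = solve-∀

lemma3p1 : Σ ℕ λ K → Σ ℕ λ s₀ →
    ∀ (Π : GraphClass) → IsoClosed Π →
    ∀ (ε : ℚ) → 0ℚ Q.< ε → ε Q.≤ 1ℚ →
    ∀ (s : ℕ) → CanonicalTester Π ε s → s₀ ≤ s →
    ∀ (n : ℕ) → s ^ 4 ≤ n → (G : Graph n) → Far ε Π G →
    ∀ (L : List (Fin (s ^ 4) → Fin n)) → L ⊆ subsets n (s ^ 4) → All (λ f → Π (s ^ 4) (induced G f)) L →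
      length L ^ suc K * 2 ^ s ≤ total n (s ^ 4) ^ suc K
lemma3p1 = 1 , 12 , λ Π _ ε _ _ s T 12≤s n m≤n G far L L⊆ all-in-Π →
  let open CanonicalTester T
      open Verdicts G decide isoInvar
      m = s ^ 4
      s≥1 = ≤-trans (s≤s z≤n) 12≤s
      s≤m = m≤m*n s (s ^ 3) {{m^n≢0 s 3 {{>-nonZero s≥1}}}}
      accepts-most : ∀ {f} → Π m (induced G f) → 2 * choose m s ≤ 3 * countAccept decide (induced G f)
      accepts-most {f} f∈Π = subst (λ c → 2 * c ≤ 3 * countAccept decide (induced G f)) (total-choose m s)
                               (complete m s≤m (induced G f) f∈Π)
      rejects-most = subst₂ (λ a c → 3 * a ≤ c) accepted-all (total-choose n s) (sound n (≤-trans s≤m m≤n) G far)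
  in subst (λ N → length L ^ 2 * 2 ^ s ≤ N ^ 2) (sym (total-choose n m))
       (square-bound (length L) (choose n m) s
         (≤-trans (*-monoˡ-≤ (7 ^ s) (good-list-bound m L L⊆ (All.map accepts-most all-in-Π)))
                  (Packings.good-sets-bound s acc acc≤1 m s≥1 (twelve-cubes s 12≤s) m≤n rejects-most)))
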